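{- Let $p\ge2$ and $P=\{312,2431,(p+1)p\cdots21\}$. If $\alpha\in S_n(P)$, $n\ge1$, has $k$ active sites, then $\alpha=\lambda^{\downarrow k}$ or $\alpha=\lambda^{\downarrow(k-1)}$ for some $\lambda\in S_{n-1}(P)$.
   Context: A permutation contains a pattern $\sigma$ if some subsequence is order-isomorphic to $\sigma$, and avoids it otherwise; $S_n(P)$ is the set of permutations of $\{1,\dots,n\}$ avoiding every pattern in $P$. A site of a length-$n$ permutation is one of its $n+1$ gaps, numbered from right to left (site $1$ is after the last entry). $\lambda^{\downarrow i}$ is obtained from $\lambda\in S_{n-1}$ by inserting $n$ into site $i$. For $\alpha\in S_n(P)$, site $i$ is active if $\alpha^{\downarrow i}\in S_{n+1}(P)$; the number of active sites is the number of such $i$. -}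

module Defs where

open import Data.Nat using (ℕ; zero; suc; _+_; _∸_; _<_; _≤_)
open import Data.List using (List; []; _∷_; _++_; take; drop; length; applyUpTo; applyDownFrom)
open import Data.List.Relation.Binary.Sublist.Propositional using (_⊆_)
open import Data.List.Relation.Binary.Permutation.Propositional using (_↭_)
open import Data.List.Relation.Unary.All using (All)
open import Data.List.Relation.Unary.Unique.Propositional using (Unique)
open import Data.List.Membership.Propositional using (_∈_)
open import Data.Product using (_×_; ∃)
open import Data.Empty using (⊥)
open import Data.Unit using (⊤)
open import Function.Bundles using (_⇔_)
open import Relation.Nullary using (¬_)
open import Relation.Binary.PropositionalEquality using (_≡_)

range : ℕ → List ℕ
range n = applyUpTo suc n

IsPerm : ℕ → List ℕ → Set
IsPerm n π = π ↭ range n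

OrderIso : List ℕ → List ℕ → Set
OrderIso [] [] = ⊤
OrderIso [] (_ ∷ _) = ⊥
OrderIso (_ ∷ _) [] = ⊥
OrderIso (x ∷ xs) (y ∷ ys) = HeadCmp x y xs ys × OrderIso xs ys
  where
  HeadCmp : ℕ → ℕ → List ℕ → List ℕ → Set
  HeadCmp x y [] [] = ⊤
  HeadCmp x y [] (_ ∷ _) = ⊥
  HeadCmp x y (_ ∷ _) [] = ⊥
  HeadCmp x y (x' ∷ xs') (y' ∷ ys') =
    ((x < x') ⇔ (y < y')) × ((x' < x) ⇔ (y' < y)) × HeadCmp x y xs' ys'

Contains : List ℕ → List ℕ → Set
Contains π σ = ∃ λ τ → (τ ⊆ π) × OrderIso τ σ

Avoids : List (List ℕ) → List ℕ → Set
Avoids P π = All (λ σ → ¬ Contains π σ) P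

InS : ℕ → List (List ℕ) → List ℕ → Set
InS n P π = IsPerm n π × Avoids P π

-- Insert value x into site i of λ; sites are numbered right to left,
-- site 1 being after the last entry, site (length λ + 1) before the first.
-- (Only meaningful for 1 ≤ i ≤ length λ + 1; range is imposed where used.)
insertSite : List ℕ → ℕ → ℕ → List ℕ
insertSite l x i = take (length l + 1 ∸ i) l ++ (x ∷ drop (length l + 1 ∸ i) l)

_↓_ : List ℕ → ℕ → List ℕ
l ↓ i = insertSite l (suc (length l)) i

IsInsertion : List ℕ → ℕ → List ℕ → Set
IsInsertion l i α = (1 ≤ i) × (i ≤ length l + 1) × (α ≡ (l ↓ i))

Active : List (List ℕ) → List ℕ → ℕ → Set
Active P α i = InS (suc (length α)) P (α ↓ i)

HasActiveSites : List (List ℕ) → List ℕ → ℕ → Set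
HasActiveSites P α k =
  ∃ λ (ss : List ℕ) → Unique ss × length ss ≡ k ×
    (∀ i → (i ∈ ss) ⇔ ((1 ≤ i) × (i ≤ length α + 1) × Active P α i))

P-set : ℕ → List (List ℕ)
P-set p = (3 ∷ 1 ∷ 2 ∷ []) ∷ (2 ∷ 4 ∷ 3 ∷ 1 ∷ []) ∷ applyDownFrom suc (suc p) ∷ []

module Submission where

-- Write α = xs ++ n ∷ ys with n = max α, so that α = λ↓(|ys|+1) for λ = xs ++ ys ∈ S_{n-1}(P).
-- Every site to the right of n is active, and no site to the left of the one just before n is,
-- so the active sites are 1, …, |ys|+1 and possibly |ys|+2: k is |ys|+1 or |ys|+2.

open import Defs
open import Data.Nat using (ℕ; zero; suc; _+_; _∸_; _<_; _≤_; z≤n; s≤s; _<?_; _≤?_)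
open import Data.Nat.Properties
open import Data.List using (List; []; _∷_; _++_; [_]; take; drop; length; applyDownFrom)
open import Data.List.Properties
  using (length-++; length-++-sucʳ; length-++-≤ʳ; length-drop; length-applyUpTo; applyUpTo-∷ʳ;
         ++-assoc; ++-identityʳ; take++drop≡id; ∷-injective)
open import Data.List.Relation.Binary.Sublist.Propositional
  using (_⊆_; []; _∷_; _∷ʳ_; ⊆-refl; ⊆-trans; minimum; from∈; to∈)
open import Data.List.Relation.Binary.Sublist.Propositional.Properties using (++⁺ˡ; ++⁺; All-resp-⊆)
open import Data.List.Relation.Binary.Permutation.Propositional using (_↭_; ↭-sym; ↭-trans)
open import Data.List.Relation.Binary.Permutation.Propositional.Properties
  using (shift; ++⁺ʳ; ∷↭∷ʳ; drop-mid; ∈-resp-↭; ↭-length)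
open import Data.List.Relation.Unary.All using (All; []; _∷_)
import Data.List.Relation.Unary.All as All
import Data.List.Relation.Unary.All.Properties as All
open import Data.List.Relation.Unary.Any using (here; there)
open import Data.List.Relation.Unary.AllPairs using ([]; _∷_)
open import Data.List.Relation.Unary.Unique.Propositional using (Unique)
open import Data.List.Relation.Unary.Unique.Propositional.Properties using (applyUpTo⁺₁)
open import Data.List.Membership.Propositional using (_∈_)
open import Data.List.Membership.Propositional.Properties
  using (∈-∃++; ∈-++⁻; ∈-++⁺ˡ; ∈-++⁺ʳ; ∈-applyUpTo⁺; ∈-applyUpTo⁻; ∈-applyDownFrom⁻)
open import Data.Product using (_×_; ∃; ∃₂; _,_; proj₁; proj₂)
open import Data.Sum using (_⊎_; inj₁; inj₂)
open import Data.Empty using (⊥-elim)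
open import Data.Unit using (tt)
open import Function using (_∘_)
open import Function.Bundles using (_⇔_; mk⇔; Equivalence)
open import Relation.Nullary using (¬_; yes; no)
open import Relation.Nullary.Decidable using (True; False; toWitness; toWitnessFalse)
open import Relation.Binary.PropositionalEquality
  using (_≡_; refl; sym; trans; cong; cong₂; subst; _≢_; module ≡-Reasoning)

⊆-insert⁻ : ∀ (A : List ℕ) {x B τ} → τ ⊆ A ++ x ∷ B →
  τ ⊆ A ++ B ⊎ ∃₂ λ τ₁ τ₂ → τ ≡ τ₁ ++ x ∷ τ₂ × τ₁ ⊆ A × τ₂ ⊆ B
⊆-insert⁻ [] (_ ∷ʳ τ⊆) = inj₁ τ⊆
⊆-insert⁻ [] {τ = _ ∷ τ} (refl ∷ τ⊆) = inj₂ ([] , τ , refl , [] , τ⊆)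
⊆-insert⁻ (a ∷ A) (_ ∷ʳ τ⊆) with ⊆-insert⁻ A τ⊆
... | inj₁ τ⊆′ = inj₁ (a ∷ʳ τ⊆′)
... | inj₂ (τ₁ , τ₂ , eq , τ₁⊆ , τ₂⊆) = inj₂ (τ₁ , τ₂ , eq , a ∷ʳ τ₁⊆ , τ₂⊆)
⊆-insert⁻ (a ∷ A) {τ = t ∷ _} (refl ∷ τ⊆) with ⊆-insert⁻ A τ⊆
... | inj₁ τ⊆′ = inj₁ (refl ∷ τ⊆′)
... | inj₂ (τ₁ , τ₂ , eq , τ₁⊆ , τ₂⊆) = inj₂ (t ∷ τ₁ , τ₂ , cong (t ∷_) eq , refl ∷ τ₁⊆ , τ₂⊆)

++-suffix : ∀ {A : Set} (xs ys us vs : List A) → xs ++ ys ≡ us ++ vs → length vs ≤ length ys →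
  ∃ λ zs → ys ≡ zs ++ vs × us ≡ xs ++ zs
++-suffix [] ys us vs eq _ = us , eq , refl
++-suffix (x ∷ xs) ys [] vs eq vs≤ys =
  ⊥-elim (<-irrefl refl (≤-trans (s≤s (≤-trans vs≤ys (length-++-≤ʳ ys {xs}))) (≤-reflexive (cong length eq))))
++-suffix (x ∷ xs) ys (u ∷ us) vs eq vs≤ys with ∷-injective eq
... | refl , eq′ with ++-suffix xs ys us vs eq′ vs≤ys
...   | zs , ys≡ , us≡ = zs , ys≡ , cong (x ∷_) us≡

∈-++-∷⁻ : ∀ {A : Set} {z x : A} xs {ys} → z ∈ xs ++ x ∷ ys → z ≢ x → z ∈ xs ++ ys
∈-++-∷⁻ xs z∈ z≢x with ∈-++⁻ xs z∈
... | inj₁ z∈xs = ∈-++⁺ˡ z∈xs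
... | inj₂ (here z≡x) = ⊥-elim (z≢x z≡x)
... | inj₂ (there z∈ys) = ∈-++⁺ʳ xs z∈ys

Unique-length-≤ : ∀ {A : Set} {xs ys : List A} → Unique xs → (∀ {z} → z ∈ xs → z ∈ ys) → length xs ≤ length ys
Unique-length-≤ {xs = []} _ _ = z≤n
Unique-length-≤ {xs = x ∷ xs} (x∉xs ∷ xs!) xs⊆ with ∈-∃++ (xs⊆ (here refl))
... | us , vs , refl = subst (suc (length xs) ≤_) (sym (length-++-sucʳ us x vs))
  (s≤s (Unique-length-≤ xs! (λ z∈xs → ∈-++-∷⁻ us (xs⊆ (there z∈xs)) (λ z≡x → All.lookup x∉xs z∈xs (sym z≡x)))))

∈-range⁺ : ∀ {i n} → 1 ≤ i → i ≤ n → i ∈ range n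
∈-range⁺ {suc i} _ i<n = ∈-applyUpTo⁺ suc i<n

∈-range⁻ : ∀ {i n} → i ∈ range n → 1 ≤ i × i ≤ n
∈-range⁻ i∈ with ∈-applyUpTo⁻ suc i∈
... | _ , i<n , refl = s≤s z≤n , i<n

Unique-range : ∀ n → Unique (range n)
Unique-range n = applyUpTo⁺₁ suc n (λ i<j _ → <⇒≢ (s≤s i<j))

Unique-length-pinched : ∀ {ss : List ℕ} j → Unique ss → (∀ {i} → i ∈ range j → i ∈ ss) →
  (∀ {i} → i ∈ ss → i ∈ range (suc j)) → length ss ≡ j ⊎ length ss ≡ suc j
Unique-length-pinched {ss} j ss! range⊆ss ss⊆range
  with m≤n⇒m<n∨m≡n (subst (length ss ≤_) (length-applyUpTo suc (suc j)) (Unique-length-≤ ss! ss⊆range))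
... | inj₁ (s≤s ss≤j) =
  inj₁ (≤-antisym ss≤j
    (subst (_≤ length ss) (length-applyUpTo suc j) (Unique-length-≤ (Unique-range j) range⊆ss)))
... | inj₂ ss≡ = inj₂ ss≡

IsPerm-length : ∀ {n π} → IsPerm n π → length π ≡ n
IsPerm-length {n} π↭ = trans (↭-length π↭) (length-applyUpTo suc n)

IsPerm-bounded : ∀ {n π} → IsPerm n π → All (_< suc n) π
IsPerm-bounded π↭ = All.tabulate (λ i∈ → s≤s (proj₂ (∈-range⁻ (∈-resp-↭ π↭ i∈))))

IsPerm-insert : ∀ {m} xs ys → IsPerm m (xs ++ ys) → IsPerm (suc m) (xs ++ suc m ∷ ys)
IsPerm-insert {m} xs ys π↭ = ↭-trans (shift (suc m) xs ys) (↭-trans (∷↭∷ʳ (suc m) (xs ++ ys))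
  (subst ((xs ++ ys) ++ [ suc m ] ↭_) (applyUpTo-∷ʳ suc m) (++⁺ʳ [ suc m ] π↭)))

IsPerm-remove : ∀ {m} xs ys → IsPerm (suc m) (xs ++ suc m ∷ ys) → IsPerm m (xs ++ ys)
IsPerm-remove {m} xs ys π↭ = subst ((xs ++ ys) ↭_) (++-identityʳ (range m))
  (drop-mid xs (range m) (subst ((xs ++ suc m ∷ ys) ↭_) (sym (applyUpTo-∷ʳ suc m)) π↭))

IsPerm-below-max : ∀ {m} xs ys → IsPerm (suc m) (xs ++ suc m ∷ ys) → All (_< suc m) xs × All (_< suc m) ys
IsPerm-below-max xs ys α↭ = All.++⁻ xs (IsPerm-bounded (IsPerm-remove xs ys α↭))

All-<-++-∷ : ∀ {n N xs ys} → n < N → All (_< n) xs → All (_< n) ys → All (_< N) (xs ++ n ∷ ys)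
All-<-++-∷ n<N xs<n ys<n =
  All.++⁺ (All.map (λ z<n → <-trans z<n n<N) xs<n) (n<N ∷ All.map (λ z<n → <-trans z<n n<N) ys<n)

private
  lit< : ∀ {m n} → True (m <? n) → m < n
  lit< = toWitness

  lit≮ : ∀ {m n} → False (m <? n) → ¬ m < n
  lit≮ = toWitnessFalse

  both : {P Q : Set} → P → Q → P ⇔ Q
  both p q = mk⇔ (λ _ → q) (λ _ → p)

  neither : {P Q : Set} → ¬ P → ¬ Q → P ⇔ Q
  neither ¬p ¬q = mk⇔ (⊥-elim ∘ ¬p) (⊥-elim ∘ ¬q)

σ₃₁₂ σ₂₄₃₁ : List ℕ
σ₃₁₂ = 3 ∷ 1 ∷ 2 ∷ []
σ₂₄₃₁ = 2 ∷ 4 ∷ 3 ∷ 1 ∷ []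

Avoids-⊆ : ∀ {P π π′} → π ⊆ π′ → Avoids P π′ → Avoids P π
Avoids-⊆ π⊆π′ = All.map (λ ¬occ (τ , τ⊆π , iso) → ¬occ (τ , ⊆-trans τ⊆π π⊆π′ , iso))

OrderIso-headMax : ∀ {x y xs ys} → OrderIso (x ∷ xs) (y ∷ ys) → All (_< y) ys → All (_< x) xs
OrderIso-headMax {xs = []} {[]} _ _ = []
OrderIso-headMax {xs = []} {_ ∷ _} (() , _)
OrderIso-headMax {xs = _ ∷ _} {[]} (() , _)
OrderIso-headMax {xs = _ ∷ _} {_ ∷ _} ((_ , x′<x⇔ , cmp) , _ , iso) (y′<y ∷ ys<y) =
  Equivalence.from x′<x⇔ y′<y ∷ OrderIso-headMax (cmp , iso) ys<y

OrderIso-replaceHead : ∀ {x x′ xs σ} → All (_< x) xs → All (_< x′) xs →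
  OrderIso (x ∷ xs) σ → OrderIso (x′ ∷ xs) σ
OrderIso-replaceHead {xs = []} {_ ∷ []} _ _ iso = iso
OrderIso-replaceHead {xs = []} {_ ∷ _ ∷ _} _ _ (() , _)
OrderIso-replaceHead {xs = _ ∷ _} {_ ∷ []} _ _ (() , _)
OrderIso-replaceHead {xs = z ∷ zs} {_ ∷ _ ∷ _} (z<x ∷ zs<x) (z<x′ ∷ zs<x′) ((x<z⇔ , z<x⇔ , cmp) , iso)
  with OrderIso-replaceHead zs<x zs<x′ (cmp , proj₂ iso)
... | cmp′ , _ =
  (mk⇔ (λ x′<z → ⊥-elim (<-asym z<x′ x′<z)) (λ y<y′ → ⊥-elim (<-asym z<x (Equivalence.from x<z⇔ y<y′))) ,
   mk⇔ (λ _ → Equivalence.to z<x⇔ z<x) (λ _ → z<x′) , cmp′) , iso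

-- An occurrence of a pattern headed by its maximum can use the new maximum N only as its head,
-- and there N may be traded for n, which precedes B and exceeds it.
Contains-headMax-insert⁻ : ∀ {A B : List ℕ} {n N y ys} → All (_< y) ys → n ∈ A → All (_< N) A → All (_< n) B →
  Contains (A ++ N ∷ B) (y ∷ ys) → Contains (A ++ B) (y ∷ ys)
Contains-headMax-insert⁻ {A} ys<y n∈A A<N B<n (τ , τ⊆ , iso) with ⊆-insert⁻ A τ⊆
... | inj₁ τ⊆′ = τ , τ⊆′ , iso
... | inj₂ ([] , τ₂ , refl , _ , τ₂⊆) =
  _ ∷ τ₂ , ++⁺ (from∈ n∈A) τ₂⊆ , OrderIso-replaceHead (All.map (λ z<n → <-trans z<n n<N) τ₂<n) τ₂<n iso
  where
  τ₂<n = All-resp-⊆ τ₂⊆ B<n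
  n<N = All.lookup A<N n∈A
... | inj₂ (_ ∷ τ₁ , _ , refl , τ₁⊆ , _) =
  ⊥-elim (<-asym (All.lookup A<N (to∈ τ₁⊆)) (All.lookup (OrderIso-headMax iso ys<y) (∈-++⁺ʳ τ₁ (here refl))))

Contains-312⁺ : ∀ {π} a b c → a ∷ b ∷ c ∷ [] ⊆ π → b < c → c < a → Contains π σ₃₁₂
Contains-312⁺ a b c abc⊆ b<c c<a = a ∷ b ∷ c ∷ [] , abc⊆ ,
  ((neither (<-asym b<a) (lit≮ tt) , both b<a (lit< tt) ,
    neither (<-asym c<a) (lit≮ tt) , both c<a (lit< tt) , tt) ,
   (both b<c (lit< tt) , neither (<-asym b<c) (lit≮ tt) , tt) , tt , tt)
  where b<a = <-trans b<c c<a

Contains-2431⁺ : ∀ {π} a b c d → a ∷ b ∷ c ∷ d ∷ [] ⊆ π → d < a → a < c → c < b → Contains π σ₂₄₃₁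
Contains-2431⁺ a b c d abcd⊆ d<a a<c c<b = a ∷ b ∷ c ∷ d ∷ [] , abcd⊆ ,
  ((both a<b (lit< tt) , neither (<-asym a<b) (lit≮ tt) , both a<c (lit< tt) , neither (<-asym a<c) (lit≮ tt) ,
    neither (<-asym d<a) (lit≮ tt) , both d<a (lit< tt) , tt) ,
   (neither (<-asym c<b) (lit≮ tt) , both c<b (lit< tt) ,
    neither (<-asym d<b) (lit≮ tt) , both d<b (lit< tt) , tt) ,
   (neither (<-asym d<c) (lit≮ tt) , both d<c (lit< tt) , tt) , tt , tt)
  where
  a<b = <-trans a<c c<b
  d<c = <-trans d<a a<c
  d<b = <-trans d<c c<b

Contains-2431⁻ : ∀ {π} → Contains π σ₂₄₃₁ →
  ∃ λ a → ∃ λ b → ∃ λ c → ∃ λ d → a ∷ b ∷ c ∷ d ∷ [] ⊆ π × d < a × a < c × c < b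
Contains-2431⁻ ([] , _ , ())
Contains-2431⁻ (_ ∷ [] , _ , (() , _))
Contains-2431⁻ (_ ∷ _ ∷ [] , _ , ((_ , _ , ()) , _))
Contains-2431⁻ (_ ∷ _ ∷ _ ∷ [] , _ , ((_ , _ , _ , _ , ()) , _))
Contains-2431⁻ (_ ∷ _ ∷ _ ∷ _ ∷ _ ∷ _ , _ , ((_ , _ , _ , _ , _ , _ , ()) , _))
Contains-2431⁻ (a ∷ b ∷ c ∷ d ∷ [] , abcd⊆ , ((_ , _ , a<c⇔ , _ , _ , d<a⇔ , _) , (_ , c<b⇔ , _) , _)) =
  a , b , c , d , abcd⊆ ,
  Equivalence.from d<a⇔ (lit< tt) , Equivalence.from a<c⇔ (lit< tt) , Equivalence.from c<b⇔ (lit< tt)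

module _ {n N : ℕ} (xs ys zs : List ℕ) (n<N : n < N)
         (xs<n : All (_< n) xs) (ys<n : All (_< n) ys) (zs<n : All (_< n) zs) where

  private
    A<N : All (_< N) (xs ++ n ∷ ys)
    A<N = All-<-++-∷ n<N xs<n ys<n

    -- N can only play the 4; if the 2 precedes n, then n can play the 4 instead,
    -- and otherwise n, 2, 3 is a 312.
    from-entries : ∀ a b c d → a ∷ b ∷ c ∷ d ∷ [] ⊆ (xs ++ n ∷ ys) ++ N ∷ zs → d < a → a < c → c < b →
      Contains (xs ++ n ∷ ys ++ zs) σ₃₁₂ ⊎ Contains (xs ++ n ∷ ys ++ zs) σ₂₄₃₁
    from-entries a b c d abcd⊆ d<a a<c c<b with ⊆-insert⁻ (xs ++ n ∷ ys) abcd⊆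
    ... | inj₁ abcd⊆′ =
      inj₂ (Contains-2431⁺ a b c d (subst (_ ⊆_) (++-assoc xs (n ∷ ys) zs) abcd⊆′) d<a a<c c<b)
    ... | inj₂ ([] , _ , refl , _ , bcd⊆) =
      ⊥-elim (<-asym (<-trans a<c c<b) (<-trans (All.lookup zs<n (to∈ bcd⊆)) n<N))
    ... | inj₂ (_ ∷ [] , _ , refl , a⊆ , cd⊆) with ∈-++⁻ xs (to∈ a⊆)
    ...   | inj₁ a∈xs = inj₂ (Contains-2431⁺ a n c d (++⁺ (from∈ a∈xs) (refl ∷ ++⁺ˡ ys cd⊆)) d<a a<c c<n)
      where c<n = All.lookup zs<n (to∈ cd⊆)
    ...   | inj₂ (here refl) = ⊥-elim (<-asym a<c (All.lookup zs<n (to∈ cd⊆)))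
    ...   | inj₂ (there a∈ys) =
      inj₁ (Contains-312⁺ n a c (++⁺ˡ xs (refl ∷ ++⁺ (from∈ a∈ys) (from∈ (to∈ cd⊆))))
        a<c (All.lookup zs<n (to∈ cd⊆)))
    from-entries a b c d abcd⊆ d<a a<c c<b | inj₂ (_ ∷ _ ∷ [] , _ , refl , ab⊆ , _)
      with _ ∷ b<N ∷ [] ← All-resp-⊆ ab⊆ A<N = ⊥-elim (<-asym c<b b<N)
    from-entries a b c d abcd⊆ d<a a<c c<b | inj₂ (_ ∷ _ ∷ _ ∷ [] , _ , refl , abc⊆ , _)
      with a<N ∷ _ ← All-resp-⊆ abc⊆ A<N = ⊥-elim (<-asym d<a a<N)
    from-entries a b c d abcd⊆ d<a a<c c<b | inj₂ (_ ∷ _ ∷ _ ∷ _ ∷ [] , _ , () , _ , _)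
    from-entries a b c d abcd⊆ d<a a<c c<b | inj₂ (_ ∷ _ ∷ _ ∷ _ ∷ _ ∷ _ , _ , () , _ , _)

  Contains-2431-insert⁻ : Contains ((xs ++ n ∷ ys) ++ N ∷ zs) σ₂₄₃₁ →
    Contains (xs ++ n ∷ ys ++ zs) σ₃₁₂ ⊎ Contains (xs ++ n ∷ ys ++ zs) σ₂₄₃₁
  Contains-2431-insert⁻ occ with a , b , c , d , abcd⊆ , d<a , a<c , c<b ← Contains-2431⁻ occ =
    from-entries a b c d abcd⊆ d<a a<c c<b

applyDownFrom-headMax : ∀ p → All (_< suc p) (applyDownFrom suc p)
applyDownFrom-headMax p = All.tabulate λ v∈ → below (∈-applyDownFrom⁻ suc v∈)
  where
  below : ∀ {v} → ∃ (λ i → i < p × v ≡ suc i) → v < suc p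
  below (_ , i<p , refl) = s≤s i<p

Avoids-insert-right : ∀ p {n N} xs ys zs → n < N → All (_< n) xs → All (_< n) ys → All (_< n) zs →
  Avoids (P-set p) (xs ++ n ∷ ys ++ zs) → Avoids (P-set p) ((xs ++ n ∷ ys) ++ N ∷ zs)
Avoids-insert-right p {n} {N} xs ys zs n<N xs<n ys<n zs<n (¬312 ∷ ¬2431 ∷ ¬dec ∷ []) =
  headMax (lit< tt ∷ lit< tt ∷ []) ¬312 ∷ ¬2431′ ∷ headMax (applyDownFrom-headMax p) ¬dec ∷ []
  where
  headMax : ∀ {y σ} → All (_< y) σ → ¬ Contains (xs ++ n ∷ ys ++ zs) (y ∷ σ) →
    ¬ Contains ((xs ++ n ∷ ys) ++ N ∷ zs) (y ∷ σ)
  headMax σ<y ¬occ = ¬occ ∘ subst (λ π → Contains π _) (++-assoc xs (n ∷ ys) zs)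
    ∘ Contains-headMax-insert⁻ σ<y (∈-++⁺ʳ xs (here refl)) (All-<-++-∷ n<N xs<n ys<n) zs<n
  ¬2431′ : ¬ Contains ((xs ++ n ∷ ys) ++ N ∷ zs) σ₂₄₃₁
  ¬2431′ occ with Contains-2431-insert⁻ xs ys zs n<N xs<n ys<n zs<n occ
  ... | inj₁ occ′ = ¬312 occ′
  ... | inj₂ occ′ = ¬2431 occ′

↓-split : ∀ α {i} → 1 ≤ i → i ≤ length α + 1 →
  ∃₂ λ A B → α ≡ A ++ B × suc (length B) ≡ i × α ↓ i ≡ A ++ suc (length α) ∷ B
↓-split α {suc i} _ i<α = take k α , drop k α , sym (take++drop≡id k α) , cong suc length-drop-k , refl
  where
  k = length α + 1 ∸ suc i
  length-drop-k : length (drop k α) ≡ i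
  length-drop-k = begin
    length (drop k α)        ≡⟨ length-drop k α ⟩
    length α ∸ k             ≡⟨ cong (λ l → length α ∸ (l ∸ suc i)) (+-comm (length α) 1) ⟩
    length α ∸ (length α ∸ i) ≡⟨ m∸[m∸n]≡n (≤-pred (subst (suc i ≤_) (+-comm (length α) 1) i<α)) ⟩
    i                        ∎
    where open ≡-Reasoning

take-length-++ : ∀ {A : Set} (xs ys : List A) → take (length xs) (xs ++ ys) ≡ xs
take-length-++ [] ys = refl
take-length-++ (x ∷ xs) ys = cong (x ∷_) (take-length-++ xs ys)

drop-length-++ : ∀ {A : Set} (xs ys : List A) → drop (length xs) (xs ++ ys) ≡ ys
drop-length-++ [] ys = refl
drop-length-++ (x ∷ xs) ys = drop-length-++ xs ys

↓-++ : ∀ xs ys → (xs ++ ys) ↓ suc (length ys) ≡ xs ++ suc (length (xs ++ ys)) ∷ ys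
↓-++ xs ys = trans (cong (λ k → take k (xs ++ ys) ++ N ∷ drop k (xs ++ ys)) offset)
  (cong₂ (λ us vs → us ++ N ∷ vs) (take-length-++ xs ys) (drop-length-++ xs ys))
  where
  N = suc (length (xs ++ ys))
  a = length xs
  b = length ys
  offset : length (xs ++ ys) + 1 ∸ suc b ≡ a
  offset = begin
    length (xs ++ ys) + 1 ∸ suc b ≡⟨ cong (λ l → l + 1 ∸ suc b) (length-++ xs) ⟩
    a + b + 1 ∸ suc b             ≡⟨ cong (_∸ suc b) (+-assoc a b 1) ⟩
    a + (b + 1) ∸ suc b           ≡⟨ cong (λ l → a + l ∸ suc b) (+-comm b 1) ⟩
    a + suc b ∸ suc b             ≡⟨ m+n∸n≡m a (suc b) ⟩
    a                             ∎
    where open ≡-Reasoning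

IsPerm-↓ : ∀ {α i} → IsPerm (length α) α → 1 ≤ i → i ≤ length α + 1 → IsPerm (suc (length α)) (α ↓ i)
IsPerm-↓ {α} α↭ 1≤i i≤ with ↓-split α 1≤i i≤
... | A , B , refl , _ , ↓≡ = subst (IsPerm _) (sym ↓≡) (IsPerm-insert A B α↭)

right-site-avoids : ∀ p {m} xs ys → IsPerm (suc m) (xs ++ suc m ∷ ys) → Avoids (P-set p) (xs ++ suc m ∷ ys) →
  ∀ {i} → 1 ≤ i → i ≤ suc (length ys) → Avoids (P-set p) ((xs ++ suc m ∷ ys) ↓ i)
right-site-avoids p {m} xs ys α↭ α-avoids {suc i} 1≤i (s≤s i≤ys)
  with ↓-split (xs ++ suc m ∷ ys) 1≤i
         (≤-trans (s≤s i≤ys) (≤-trans (length-++-≤ʳ (suc m ∷ ys) {xs}) (m≤m+n _ 1)))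
... | A , B , α≡ , refl , ↓≡
  with ++-suffix (xs ++ [ suc m ]) ys A B (trans (++-assoc xs [ suc m ] ys) α≡) i≤ys
... | zs , refl , refl rewrite ↓≡ | ++-assoc xs [ suc m ] zs =
  Avoids-insert-right p xs zs B n<N xs<n (All.++⁻ˡ zs zs++B<n) (All.++⁻ʳ zs zs++B<n) α-avoids
  where
  n<N = s≤s (≤-reflexive (sym (IsPerm-length α↭)))
  xs<n = proj₁ (IsPerm-below-max xs (zs ++ B) α↭)
  zs++B<n = proj₂ (IsPerm-below-max xs (zs ++ B) α↭)

-- A site left of the one just before n puts N before an entry c of xs, and N, c, n is a 312.
active-site-≤ : ∀ p {m} xs ys → IsPerm (suc m) (xs ++ suc m ∷ ys) →
  ∀ {i} → 1 ≤ i → i ≤ length (xs ++ suc m ∷ ys) + 1 → Avoids (P-set p) ((xs ++ suc m ∷ ys) ↓ i) →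
  i ≤ suc (suc (length ys))
active-site-≤ p {m} xs ys α↭ {i} 1≤i i≤ avoids with i ≤? suc (suc (length ys))
... | yes i≤j = i≤j
... | no i≰j with ↓-split (xs ++ suc m ∷ ys) 1≤i i≤
...   | A , B , α≡ , refl , ↓≡ with ++-suffix A B xs (suc m ∷ ys) (sym α≡) (<⇒≤ (≤-pred (≰⇒> i≰j)))
...     | [] , refl , _ = ⊥-elim (i≰j ≤-refl)
...     | c ∷ zs , refl , refl with ¬312 ∷ _ ← avoids =
  ⊥-elim (¬312 (subst (λ π → Contains π σ₃₁₂) (sym ↓≡)
    (Contains-312⁺ _ c (suc m) (++⁺ˡ A (refl ∷ refl ∷ ++⁺ˡ zs (refl ∷ minimum ys))) c<n n<N)))
  where
  n<N = s≤s (≤-reflexive (sym (IsPerm-length α↭)))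
  c<n = All.lookup (proj₁ (IsPerm-below-max (A ++ c ∷ zs) ys α↭)) (∈-++⁺ʳ A (here refl))

IsInsertion-max : ∀ {m} xs ys → IsPerm m (xs ++ ys) →
  IsInsertion (xs ++ ys) (suc (length ys)) (xs ++ suc m ∷ ys)
IsInsertion-max xs ys l↭ =
  s≤s z≤n ,
  subst (suc (length ys) ≤_) (+-comm 1 (length (xs ++ ys))) (s≤s (length-++-≤ʳ ys {xs})) ,
  sym (trans (↓-++ xs ys) (cong (λ k → xs ++ suc k ∷ ys) (IsPerm-length l↭)))

corollary2 : (p : ℕ) → 2 ≤ p → (n : ℕ) → 1 ≤ n → (α : List ℕ) → InS n (P-set p) α →
    (k : ℕ) → HasActiveSites (P-set p) α k →
      ∃ λ (l : List ℕ) → InS (n ∸ 1) (P-set p) l ×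
        (IsInsertion l k α ⊎ IsInsertion l (k ∸ 1) α)
corollary2 _ _ zero () _ _ _ _
corollary2 p _ (suc m) _ α (α↭ , α-avoids) k (ss , ss! , refl , ss⇔)
  with ∈-∃++ (∈-resp-↭ (↭-sym α↭) (∈-range⁺ {suc m} (s≤s z≤n) ≤-refl))
... | xs , ys , refl = xs ++ ys , (l↭ , Avoids-⊆ (++⁺ ⊆-refl (suc m ∷ʳ ⊆-refl)) α-avoids) , insertion
  where
  j = suc (length ys)
  l↭ = IsPerm-remove xs ys α↭
  α↭′ = subst (λ n → IsPerm n α) (sym (IsPerm-length α↭)) α↭
  j≤ : j ≤ length α + 1
  j≤ = ≤-trans (length-++-≤ʳ (suc m ∷ ys) {xs}) (m≤m+n _ 1)
  range⊆ss : ∀ {i} → i ∈ range j → i ∈ ss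
  range⊆ss i∈ with 1≤i , i≤j ← ∈-range⁻ i∈ = Equivalence.from (ss⇔ _)
    (1≤i , ≤-trans i≤j j≤ , IsPerm-↓ α↭′ 1≤i (≤-trans i≤j j≤) , right-site-avoids p xs ys α↭ α-avoids 1≤i i≤j)
  ss⊆range : ∀ {i} → i ∈ ss → i ∈ range (suc j)
  ss⊆range i∈ with 1≤i , i≤ , _ , avoids ← Equivalence.to (ss⇔ _) i∈ =
    ∈-range⁺ 1≤i (active-site-≤ p xs ys α↭ 1≤i i≤ avoids)
  insertion : IsInsertion (xs ++ ys) (length ss) α ⊎ IsInsertion (xs ++ ys) (length ss ∸ 1) α
  insertion with Unique-length-pinched j ss! range⊆ss ss⊆range
  ... | inj₁ ss≡j = inj₁ (subst (λ i → IsInsertion _ i α) (sym ss≡j) (IsInsertion-max xs ys l↭))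
  ... | inj₂ ss≡1+j = inj₂ (subst (λ i → IsInsertion _ (i ∸ 1) α) (sym ss≡1+j) (IsInsertion-max xs ys l↭))
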